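{- Let $\Sigma$ be any subexponential signature. A sequent is derivable in $\mathrm{SMALC}_\Sigma+(\mathrm{cut})$ if and only if it is derivable in (cut-free) $\mathrm{SMALC}_\Sigma$.
   Context: A subexponential signature is a tuple $\Sigma = \langle \mathcal{I}, \preceq, \mathcal{W}, \mathcal{C}, \mathcal{E}\rangle$ where $\mathcal{I}$ is a finite set of labels, $\preceq$ is a preorder on $\mathcal{I}$, and $\mathcal{W},\mathcal{C},\mathcal{E}\subseteq\mathcal{I}$ are upwardly closed with respect to $\preceq$, and $\mathcal{W}\cap\mathcal{C}\subseteq\mathcal{E}$. $\mathrm{SMALC}_\Sigma$: formulae are built from variables $p_1,p_2,\dots$ and the constant $\mathbf{1}$ using $\cdot$, $\backslash$, $/$, $\wedge$, $\vee$ and ${!}^s$ ($s\in\mathcal{I}$). Sequents are $\Gamma\to C$, $\Gamma$ a finite, possibly empty, sequence of formulae. Axioms and rules (cut-free): (ax) $A\to A$; ($\to\mathbf{1}$) $\to\mathbf{1}$; ($\cdot\to$) from $\Gamma_1,A,B,\Gamma_2\to C$ infer $\Gamma_1,A\cdot B,\Gamma_2\to C$; ($\to\cdot$) from $\Gamma_1\to A$ and $\Gamma_2\to B$ infer $\Gamma_1,\Gamma_2\to A\cdot B$; ($\backslash\to$) from $\Pi\to A$ and $\Gamma_1,B,\Gamma_2\to C$ infer $\Gamma_1,\Pi,A\backslash B,\Gamma_2\to C$; ($\to\backslash$) from $A,\Pi\to B$ infer $\Pi\to A\backslash B$; ($/\to$) from $\Pi\to A$ and $\Gamma_1,B,\Gamma_2\to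 C$ infer $\Gamma_1,B/A,\Pi,\Gamma_2\to C$; ($\to/$) from $\Pi,A\to B$ infer $\Pi\to B/A$; ($\mathbf{1}\to$) from $\Gamma_1,\Gamma_2\to C$ infer $\Gamma_1,\mathbf{1},\Gamma_2\to C$; ($\vee\to$) from $\Gamma_1,A_1,\Gamma_2\to C$ and $\Gamma_1,A_2,\Gamma_2\to C$ infer $\Gamma_1,A_1\vee A_2,\Gamma_2\to C$; ($\to\vee$) from $\Gamma\to A_i$ infer $\Gamma\to A_1\vee A_2$; ($\wedge\to$) from $\Gamma_1,A_i,\Gamma_2\to C$ infer $\Gamma_1,A_1\wedge A_2,\Gamma_2\to C$; ($\to\wedge$) from $\Gamma\to A_1$ and $\Gamma\to A_2$ infer $\Gamma\to A_1\wedge A_2$; (${!}\to$) from $\Gamma_1,A,\Gamma_2\to C$ infer $\Gamma_1,{!}^sA,\Gamma_2\to C$; ($\to{!}$) from ${!}^{s_1}A_1,\dots,{!}^{s_n}A_n\to B$ infer ${!}^{s_1}A_1,\dots,{!}^{s_n}A_n\to{!}^sB$ provided $s\preceq s_j$ for all $j$; (weak) for $s\in\mathcal{W}$: from $\Gamma_1,\Gamma_2\to C$ infer $\Gamma_1,{!}^sA,\Gamma_2\to C$; (ncontr) for $s\in\mathcal{C}$: from $\Gamma_1,{!}^sA,\Delta,{!}^sA,\Gamma_2\to C$ infer $\Gamma_1,{!}^sA,\Delta,\Gamma_2\to C$, and also $\Gamma_1,\Delta,{!}^sA,\Gamma_2\to C$; (ex) for $s\in\mathcal{E}$: from $\Gamma_1,\Delta,{!}^sA,\Gamma_2\to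 C$ infer $\Gamma_1,{!}^sA,\Delta,\Gamma_2\to C$, and from $\Gamma_1,{!}^sA,\Delta,\Gamma_2\to C$ infer $\Gamma_1,\Delta,{!}^sA,\Gamma_2\to C$. Cut: from $\Pi\to A$ and $\Gamma_1,A,\Gamma_2\to C$ infer $\Gamma_1,\Pi,\Gamma_2\to C$; $\mathrm{SMALC}_\Sigma+(\mathrm{cut})$ is the system with cut added. -}

module Defs where

open import Data.Nat using (ℕ)
open import Data.Fin using (Fin)
open import Data.Bool using (Bool; true; false)
open import Data.List using (List; []; _∷_; _++_; map)
open import Data.List.Relation.Unary.All using (All)
open import Data.Product using (_×_; _,_; proj₁; proj₂)
open import Relation.Binary.PropositionalEquality using (_≡_)

-- A subexponential signature ⟨ I , ≼ , W , C , E ⟩.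
-- The finite label set I is represented as Fin n.
record SubexpSig : Set₁ where
  field
    n     : ℕ
    _≼_   : Fin n → Fin n → Set
    ≼-refl  : ∀ s → s ≼ s
    ≼-trans : ∀ {r s t} → r ≼ s → s ≼ t → r ≼ t
    W C E : Fin n → Set
    W-up : ∀ {s t} → s ≼ t → W s → W t
    C-up : ∀ {s t} → s ≼ t → C s → C t
    E-up : ∀ {s t} → s ≼ t → E s → E t
    WC⊆E : ∀ s → W s → C s → E s

module _ (Σ : SubexpSig) where
  open SubexpSig Σ

  data Fm : Set where
    var  : ℕ → Fm
    𝟏    : Fm
    _·_  : Fm → Fm → Fm
    _＼_ : Fm → Fm → Fm
    _／_ : Fm → Fm → Fm
    _∧_  : Fm → Fm → Fm
    _∨_  : Fm → Fm → Fm
    ![_]_ : Fin n → Fm → Fm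

  bangs : List (Fin n × Fm) → List Fm
  bangs = map (λ p → ![ proj₁ p ] proj₂ p)

  -- Derivability; the Bool says whether cut is allowed
  -- (true: SMALC_Σ + (cut), false: cut-free SMALC_Σ).
  data Der (cutOK : Bool) : List Fm → Fm → Set where
    ax   : ∀ {A} → Der cutOK (A ∷ []) A
    →𝟏   : Der cutOK [] 𝟏
    ·→   : ∀ {Γ₁ Γ₂ A B D} → Der cutOK (Γ₁ ++ A ∷ B ∷ Γ₂) D
         → Der cutOK (Γ₁ ++ (A · B) ∷ Γ₂) D
    →·   : ∀ {Γ₁ Γ₂ A B} → Der cutOK Γ₁ A → Der cutOK Γ₂ B
         → Der cutOK (Γ₁ ++ Γ₂) (A · B)
    ＼→  : ∀ {Π Γ₁ Γ₂ A B D} → Der cutOK Π A → Der cutOK (Γ₁ ++ B ∷ Γ₂) D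
         → Der cutOK (Γ₁ ++ Π ++ (A ＼ B) ∷ Γ₂) D
    →＼  : ∀ {Π A B} → Der cutOK (A ∷ Π) B → Der cutOK Π (A ＼ B)
    ／→  : ∀ {Π Γ₁ Γ₂ A B D} → Der cutOK Π A → Der cutOK (Γ₁ ++ B ∷ Γ₂) D
         → Der cutOK (Γ₁ ++ (B ／ A) ∷ Π ++ Γ₂) D
    →／  : ∀ {Π A B} → Der cutOK (Π ++ A ∷ []) B → Der cutOK Π (B ／ A)
    𝟏→   : ∀ {Γ₁ Γ₂ D} → Der cutOK (Γ₁ ++ Γ₂) D → Der cutOK (Γ₁ ++ 𝟏 ∷ Γ₂) D
    ∨→   : ∀ {Γ₁ Γ₂ A₁ A₂ D} → Der cutOK (Γ₁ ++ A₁ ∷ Γ₂) D → Der cutOK (Γ₁ ++ A₂ ∷ Γ₂) D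
         → Der cutOK (Γ₁ ++ (A₁ ∨ A₂) ∷ Γ₂) D
    →∨₁  : ∀ {Γ A₁ A₂} → Der cutOK Γ A₁ → Der cutOK Γ (A₁ ∨ A₂)
    →∨₂  : ∀ {Γ A₁ A₂} → Der cutOK Γ A₂ → Der cutOK Γ (A₁ ∨ A₂)
    ∧₁→  : ∀ {Γ₁ Γ₂ A₁ A₂ D} → Der cutOK (Γ₁ ++ A₁ ∷ Γ₂) D
         → Der cutOK (Γ₁ ++ (A₁ ∧ A₂) ∷ Γ₂) D
    ∧₂→  : ∀ {Γ₁ Γ₂ A₁ A₂ D} → Der cutOK (Γ₁ ++ A₂ ∷ Γ₂) D
         → Der cutOK (Γ₁ ++ (A₁ ∧ A₂) ∷ Γ₂) D
    →∧   : ∀ {Γ A₁ A₂} → Der cutOK Γ A₁ → Der cutOK Γ A₂ → Der cutOK Γ (A₁ ∧ A₂)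
    !→   : ∀ {Γ₁ Γ₂ s A D} → Der cutOK (Γ₁ ++ A ∷ Γ₂) D
         → Der cutOK (Γ₁ ++ (![ s ] A) ∷ Γ₂) D
    →!   : ∀ {L s B} → All (λ p → s ≼ proj₁ p) L → Der cutOK (bangs L) B
         → Der cutOK (bangs L) (![ s ] B)
    weak : ∀ {Γ₁ Γ₂ s A D} → W s → Der cutOK (Γ₁ ++ Γ₂) D
         → Der cutOK (Γ₁ ++ (![ s ] A) ∷ Γ₂) D
    ncontr₁ : ∀ {Γ₁ Δ Γ₂ s A D} → C s
         → Der cutOK (Γ₁ ++ (![ s ] A) ∷ Δ ++ (![ s ] A) ∷ Γ₂) D
         → Der cutOK (Γ₁ ++ (![ s ] A) ∷ Δ ++ Γ₂) D
    ncontr₂ : ∀ {Γ₁ Δ Γ₂ s A D} → C s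
         → Der cutOK (Γ₁ ++ (![ s ] A) ∷ Δ ++ (![ s ] A) ∷ Γ₂) D
         → Der cutOK (Γ₁ ++ Δ ++ (![ s ] A) ∷ Γ₂) D
    ex₁  : ∀ {Γ₁ Δ Γ₂ s A D} → E s
         → Der cutOK (Γ₁ ++ Δ ++ (![ s ] A) ∷ Γ₂) D
         → Der cutOK (Γ₁ ++ (![ s ] A) ∷ Δ ++ Γ₂) D
    ex₂  : ∀ {Γ₁ Δ Γ₂ s A D} → E s
         → Der cutOK (Γ₁ ++ (![ s ] A) ∷ Δ ++ Γ₂) D
         → Der cutOK (Γ₁ ++ Δ ++ (![ s ] A) ∷ Γ₂) D
    cut  : ∀ {Π Γ₁ Γ₂ A D} → cutOK ≡ true
         → Der cutOK Π A → Der cutOK (Γ₁ ++ A ∷ Γ₂) D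
         → Der cutOK (Γ₁ ++ Π ++ Γ₂) D

  DerCut : List Fm → Fm → Set
  DerCut = Der true

  DerCutFree : List Fm → Fm → Set
  DerCutFree = Der false

-- An Okada-style phase semantics. Formulas are interpreted as sets of contexts that are
-- closed under the closure Cl, which is defined from cut-free derivability alone. Every rule,
-- including cut, is sound for this interpretation, and Okada's lemma (reflect/reify) shows
-- both that A lies in ⟦ A ⟧ and that every context in ⟦ A ⟧ derives A without cut; together
-- these turn any derivation into a cut-free one. The semantic value of a subexponential
-- formula ![ s ] A is generated by contexts consisting of !-formulas with labels above s, so
-- its weakening, exchange and contraction rules reduce to the corresponding rules for whole
-- blocks of !-formulas, which are admissible in the cut-free calculus.
module Submission where

open import Defs
open import Data.Fin using (Fin)
open import Data.List using (List; []; _∷_; _++_; [_])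
open import Data.List.Properties using (++-assoc; ++-identityʳ; map-++; ++-monoid)
open import Data.List.Relation.Unary.All using (All; []; _∷_)
import Data.List.Relation.Unary.All as All
open import Data.List.Relation.Unary.All.Properties using (++⁺)
open import Data.Product using (_×_; _,_; proj₁; proj₂)
open import Data.Sum using (_⊎_; inj₁; inj₂)
open import Function using (id; _∘_)
open import Relation.Binary.PropositionalEquality
  using (_≡_; refl; sym; cong; subst; isEquivalence)
open import Relation.Binary.Structures using (IsPreorder)
import Relation.Binary.Reasoning.Base.Double as PreorderReasoning
open import Tactic.MonoidSolver using (solve)

module CutElimination (Σ : SubexpSig) where
  open SubexpSig Σ

  Ctx : Set
  Ctx = List (Fm Σ)

  Block : Set
  Block = List (Fin n × Fm Σ)

  Labelled : (Fin n → Set) → Block → Set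
  Labelled P = All (λ p → P (proj₁ p))

  Labelled-up : ∀ {U : Fin n → Set} → (∀ {s t} → s ≼ t → U s → U t)
              → ∀ {s M} → U s → Labelled (s ≼_) M → Labelled U M
  Labelled-up up u = All.map (λ s≼t → up s≼t u)

  infix 4 _⊢_ _⇛_ _⊆_ _⊨_
  infixr 7 _⊗_ _∩_ _∪_

  _⊢_ : Ctx → Fm Σ → Set
  _⊢_ = DerCutFree Σ

  variable
    Γ Δ Θ : Ctx
    A B D : Fm Σ
    s : Fin n

  cast : Γ ≡ Δ → Γ ⊢ D → Δ ⊢ D
  cast = subst (_⊢ _)

  -- Admissible replacements in the cut-free calculus

  _⇛_ : Ctx → Ctx → Set
  Γ ⇛ Δ = ∀ Φ Ψ {D} → Φ ++ Γ ++ Ψ ⊢ D → Φ ++ Δ ++ Ψ ⊢ D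

  ⇛-reflexive : Γ ≡ Δ → Γ ⇛ Δ
  ⇛-reflexive refl _ _ d = d

  ⇛-trans : Γ ⇛ Δ → Δ ⇛ Θ → Γ ⇛ Θ
  ⇛-trans t u Φ Ψ d = u Φ Ψ (t Φ Ψ d)

  ⇛-isPreorder : IsPreorder _≡_ _⇛_
  ⇛-isPreorder = record
    { isEquivalence = isEquivalence ; reflexive = ⇛-reflexive ; trans = ⇛-trans }

  open PreorderReasoning ⇛-isPreorder using (begin_; step-≲; step-≡-⟩; step-≡-⟨; _∎)

  ⇛-++ˡ : ∀ Θ → Γ ⇛ Δ → Θ ++ Γ ⇛ Θ ++ Δ
  ⇛-++ˡ {Γ} {Δ} Θ t Φ Ψ d = cast (regroup Δ) (t (Φ ++ Θ) Ψ (cast (sym (regroup Γ)) d))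
    where
    regroup : ∀ Γ → (Φ ++ Θ) ++ Γ ++ Ψ ≡ Φ ++ (Θ ++ Γ) ++ Ψ
    regroup Γ = solve (++-monoid (Fm Σ))

  ⊢-regroup : ∀ Φ Γ Θ Ψ → Φ ++ (Γ ++ Θ) ++ Ψ ⊢ D → Φ ++ Γ ++ Θ ++ Ψ ⊢ D
  ⊢-regroup Φ Γ Θ Ψ = cast (cong (Φ ++_) (++-assoc Γ Θ Ψ))

  ⊢-ungroup : ∀ Φ Γ Θ Ψ → Φ ++ Γ ++ Θ ++ Ψ ⊢ D → Φ ++ (Γ ++ Θ) ++ Ψ ⊢ D
  ⊢-ungroup Φ Γ Θ Ψ = cast (cong (Φ ++_) (sym (++-assoc Γ Θ Ψ)))

  weakening-step : W s → ∀ Θ → Θ ⇛ ![ s ] A ∷ Θ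
  weakening-step w Θ Φ Ψ = weak {Γ₁ = Φ} {Γ₂ = Θ ++ Ψ} w

  exchange-step₁ : E s → ∀ Δ Θ → Δ ++ ![ s ] A ∷ Θ ⇛ ![ s ] A ∷ Δ ++ Θ
  exchange-step₁ e Δ Θ Φ Ψ d =
    ⊢-ungroup Φ (_ ∷ Δ) Θ Ψ (ex₁ {Γ₁ = Φ} {Δ = Δ} e (⊢-regroup Φ Δ (_ ∷ Θ) Ψ d))

  exchange-step₂ : E s → ∀ Δ Θ → ![ s ] A ∷ Δ ++ Θ ⇛ Δ ++ ![ s ] A ∷ Θ
  exchange-step₂ e Δ Θ Φ Ψ d =
    ⊢-ungroup Φ Δ (_ ∷ Θ) Ψ (ex₂ {Γ₁ = Φ} {Δ = Δ} e (⊢-regroup Φ (_ ∷ Δ) Θ Ψ d))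

  contraction-step₁ : C s → ∀ Δ Θ → ![ s ] A ∷ Δ ++ ![ s ] A ∷ Θ ⇛ ![ s ] A ∷ Δ ++ Θ
  contraction-step₁ c Δ Θ Φ Ψ d =
    ⊢-ungroup Φ (_ ∷ Δ) Θ Ψ (ncontr₁ {Γ₁ = Φ} {Δ = Δ} c (⊢-regroup Φ (_ ∷ Δ) (_ ∷ Θ) Ψ d))

  contraction-step₂ : C s → ∀ Δ Θ → ![ s ] A ∷ Δ ++ ![ s ] A ∷ Θ ⇛ Δ ++ ![ s ] A ∷ Θ
  contraction-step₂ c Δ Θ Φ Ψ d =
    ⊢-ungroup Φ Δ (_ ∷ Θ) Ψ (ncontr₂ {Γ₁ = Φ} {Δ = Δ} c (⊢-regroup Φ (_ ∷ Δ) (_ ∷ Θ) Ψ d))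

  weakening-bangs : ∀ M → Labelled W M → ∀ Θ → Θ ⇛ bangs Σ M ++ Θ
  weakening-bangs [] [] Θ = ⇛-reflexive refl
  weakening-bangs (_ ∷ M) (w ∷ ws) Θ = ⇛-trans (weakening-bangs M ws Θ) (weakening-step w _)

  exchange-bangs₁ : ∀ M → Labelled E M → ∀ Δ Θ → Δ ++ bangs Σ M ++ Θ ⇛ bangs Σ M ++ Δ ++ Θ
  exchange-bangs₁ [] [] Δ Θ = ⇛-reflexive refl
  exchange-bangs₁ (_ ∷ M) (e ∷ es) Δ Θ =
    ⇛-trans (exchange-step₁ e Δ _) (⇛-++ˡ [ _ ] (exchange-bangs₁ M es Δ Θ))

  exchange-bangs₂ : ∀ M → Labelled E M → ∀ Δ Θ → bangs Σ M ++ Δ ++ Θ ⇛ Δ ++ bangs Σ M ++ Θ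
  exchange-bangs₂ [] [] Δ Θ = ⇛-reflexive refl
  exchange-bangs₂ (_ ∷ M) (e ∷ es) Δ Θ =
    ⇛-trans (⇛-++ˡ [ _ ] (exchange-bangs₂ M es Δ Θ)) (exchange-step₂ e Δ _)

  contraction-bangs₁ : ∀ M → Labelled C M → ∀ Δ Θ
                     → bangs Σ M ++ Δ ++ bangs Σ M ++ Θ ⇛ bangs Σ M ++ Δ ++ Θ
  contraction-bangs₁ [] [] Δ Θ = ⇛-reflexive refl
  contraction-bangs₁ ((t , A) ∷ M) (c ∷ cs) Δ Θ = begin
    F ∷ K ++ Δ ++ F ∷ K ++ Θ    ≡⟨ cong (F ∷_) (++-assoc K Δ _) ⟨
    F ∷ (K ++ Δ) ++ F ∷ K ++ Θ  ≲⟨ contraction-step₁ c (K ++ Δ) (K ++ Θ) ⟩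
    F ∷ (K ++ Δ) ++ K ++ Θ      ≡⟨ cong (F ∷_) (++-assoc K Δ _) ⟩
    F ∷ K ++ Δ ++ K ++ Θ        ≲⟨ ⇛-++ˡ [ F ] (contraction-bangs₁ M cs Δ Θ) ⟩
    F ∷ K ++ Δ ++ Θ             ∎
    where
    F : Fm Σ
    F = ![ t ] A
    K : Ctx
    K = bangs Σ M

  contraction-bangs₂ : ∀ M → Labelled C M → ∀ Δ Θ
                     → bangs Σ M ++ Δ ++ bangs Σ M ++ Θ ⇛ Δ ++ bangs Σ M ++ Θ
  contraction-bangs₂ [] [] Δ Θ = ⇛-reflexive refl
  contraction-bangs₂ ((t , A) ∷ M) (c ∷ cs) Δ Θ = begin
    F ∷ K ++ Δ ++ F ∷ K ++ Θ    ≡⟨ cong (F ∷_) (++-assoc K Δ _) ⟨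
    F ∷ (K ++ Δ) ++ F ∷ K ++ Θ  ≲⟨ contraction-step₂ c (K ++ Δ) (K ++ Θ) ⟩
    (K ++ Δ) ++ F ∷ K ++ Θ      ≡⟨ ++-assoc K Δ _ ⟩
    K ++ Δ ++ F ∷ K ++ Θ        ≡⟨ cong (K ++_) (++-assoc Δ [ F ] _) ⟨
    K ++ (Δ ++ [ F ]) ++ K ++ Θ ≲⟨ contraction-bangs₂ M cs (Δ ++ [ F ]) Θ ⟩
    (Δ ++ [ F ]) ++ K ++ Θ      ≡⟨ ++-assoc Δ [ F ] _ ⟩
    Δ ++ F ∷ K ++ Θ             ∎
    where
    F : Fm Σ
    F = ![ t ] A
    K : Ctx
    K = bangs Σ M

  Pred : Set₁
  Pred = Ctx → Set

  variable
    P Q R : Pred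

  _⊆_ : Pred → Pred → Set
  P ⊆ Q = ∀ {Γ} → P Γ → Q Γ

  Cl : Pred → Pred
  Cl P Δ = ∀ Φ Ψ D → (∀ Γ → P Γ → Φ ++ Γ ++ Ψ ⊢ D) → Φ ++ Δ ++ Ψ ⊢ D

  Closed : Pred → Set
  Closed P = Cl P ⊆ P

  Cl-unit : P ⊆ Cl P
  Cl-unit p Φ Ψ D h = h _ p

  Cl-mono : P ⊆ Q → Cl P ⊆ Cl Q
  Cl-mono f c Φ Ψ D h = c Φ Ψ D λ Γ p → h Γ (f p)

  Cl-closed : Closed (Cl P)
  Cl-closed c Φ Ψ D h = c Φ Ψ D λ Γ c′ → c′ Φ Ψ D h

  Cl-elim : Closed R → P ⊆ R → Cl P ⊆ R
  Cl-elim cR f c = cR (Cl-mono f c)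

  ⊢-closed : Closed (_⊢ D)
  ⊢-closed {D} {Δ} c = cast (++-identityʳ Δ) (c [] [] D λ Γ d → cast (sym (++-identityʳ Γ)) d)

  Closed-⇛ : Closed R → Γ ⇛ Δ → R Γ → R Δ
  Closed-⇛ cR t r = cR λ Φ Ψ D h → t Φ Ψ (h _ r)

  Closed-infix : Closed R → ∀ Δ₁ Δ₂ → Closed (λ Θ → R (Δ₁ ++ Θ ++ Δ₂))
  Closed-infix cR Δ₁ Δ₂ {Θ} c = cR λ Φ Ψ D h →
    cast (regroup Φ Ψ Θ) (c (Φ ++ Δ₁) (Δ₂ ++ Ψ) D λ Γ r → cast (sym (regroup Φ Ψ Γ)) (h _ r))
    where
    regroup : ∀ Φ Ψ Γ → (Φ ++ Δ₁) ++ Γ ++ Δ₂ ++ Ψ ≡ Φ ++ (Δ₁ ++ Γ ++ Δ₂) ++ Ψ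
    regroup Φ Ψ Γ = solve (++-monoid (Fm Σ))

  Closed-prefix : Closed R → ∀ Δ₁ → Closed (λ Θ → R (Δ₁ ++ Θ))
  Closed-prefix cR Δ₁ {Θ} c = cR λ Φ Ψ D h →
    cast (regroup Φ Ψ Θ) (c (Φ ++ Δ₁) Ψ D λ Γ r → cast (sym (regroup Φ Ψ Γ)) (h _ r))
    where
    regroup : ∀ Φ Ψ Γ → (Φ ++ Δ₁) ++ Γ ++ Ψ ≡ Φ ++ (Δ₁ ++ Γ) ++ Ψ
    regroup Φ Ψ Γ = solve (++-monoid (Fm Σ))

  infixr 5 _,⊗_

  data _⊗_ (P Q : Pred) : Pred where
    _,⊗_ : ∀ {Δ₁ Δ₂} → P Δ₁ → Q Δ₂ → (P ⊗ Q) (Δ₁ ++ Δ₂)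

  _∩_ : Pred → Pred → Pred
  (P ∩ Q) Δ = P Δ × Q Δ

  _∪_ : Pred → Pred → Pred
  (P ∪ Q) Δ = P Δ ⊎ Q Δ

  data Bangs (s : Fin n) : Pred where
    block : ∀ M → Labelled (s ≼_) M → Bangs s (bangs Σ M)

  ⟦_⟧ : Fm Σ → Pred
  ⟦ var i ⟧ Δ = Δ ⊢ var i
  ⟦ 𝟏 ⟧ = Cl (_≡ [])
  ⟦ A · B ⟧ = Cl (⟦ A ⟧ ⊗ ⟦ B ⟧)
  ⟦ A ＼ B ⟧ Δ = ∀ Γ → ⟦ A ⟧ Γ → ⟦ B ⟧ (Γ ++ Δ)
  ⟦ B ／ A ⟧ Δ = ∀ Γ → ⟦ A ⟧ Γ → ⟦ B ⟧ (Δ ++ Γ)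
  ⟦ A ∧ B ⟧ = ⟦ A ⟧ ∩ ⟦ B ⟧
  ⟦ A ∨ B ⟧ = Cl (⟦ A ⟧ ∪ ⟦ B ⟧)
  ⟦ ![ s ] A ⟧ = Cl (Bangs s ∩ ⟦ A ⟧)

  ⟦⟧-closed : ∀ A → Closed ⟦ A ⟧
  ⟦⟧-closed (var i) = ⊢-closed
  ⟦⟧-closed 𝟏 = Cl-closed
  ⟦⟧-closed (A · B) = Cl-closed
  ⟦⟧-closed (A ＼ B) c Γ a = Closed-prefix (⟦⟧-closed B) Γ (Cl-mono (λ f → f Γ a) c)
  ⟦⟧-closed (B ／ A) c Γ a = Closed-infix (⟦⟧-closed B) [] Γ (Cl-mono (λ f → f Γ a) c)
  ⟦⟧-closed (A ∧ B) c = ⟦⟧-closed A (Cl-mono proj₁ c) , ⟦⟧-closed B (Cl-mono proj₂ c)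
  ⟦⟧-closed (A ∨ B) = Cl-closed
  ⟦⟧-closed (![ s ] A) = Cl-closed

  reflect : ∀ A → ⟦ A ⟧ [ A ]
  reify : ∀ A → ⟦ A ⟧ ⊆ (_⊢ A)

  reflect (var i) = ax
  reflect 𝟏 Φ Ψ D h = 𝟏→ {Γ₁ = Φ} {Γ₂ = Ψ} (h [] refl)
  reflect (A · B) Φ Ψ D h = ·→ {Γ₁ = Φ} {Γ₂ = Ψ} (h _ (reflect A ,⊗ reflect B))
  reflect (A ＼ B) Γ a = Closed-⇛ (⟦⟧-closed B) apply-＼ (reflect B)
    where
    apply-＼ : [ B ] ⇛ Γ ++ [ A ＼ B ]
    apply-＼ Φ Ψ d = cast (cong (Φ ++_) (sym (++-assoc Γ _ Ψ))) (＼→ {Γ₁ = Φ} {Γ₂ = Ψ} (reify A a) d)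
  reflect (B ／ A) Γ a =
    Closed-⇛ (⟦⟧-closed B) (λ Φ Ψ → ／→ {Γ₁ = Φ} {Γ₂ = Ψ} (reify A a)) (reflect B)
  reflect (A ∧ B) = Closed-⇛ (⟦⟧-closed A) (λ Φ Ψ → ∧₁→ {Γ₁ = Φ} {Γ₂ = Ψ}) (reflect A)
                  , Closed-⇛ (⟦⟧-closed B) (λ Φ Ψ → ∧₂→ {Γ₁ = Φ} {Γ₂ = Ψ}) (reflect B)
  reflect (A ∨ B) Φ Ψ D h = ∨→ {Γ₁ = Φ} {Γ₂ = Ψ} (h _ (inj₁ (reflect A))) (h _ (inj₂ (reflect B)))
  reflect (![ s ] A) = Cl-unit (block [ s , A ] (≼-refl s ∷ [])
                               , Closed-⇛ (⟦⟧-closed A) (λ Φ Ψ → !→ {Γ₁ = Φ} {Γ₂ = Ψ}) (reflect A))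

  reify (var i) d = d
  reify 𝟏 = Cl-elim ⊢-closed λ { refl → →𝟏 }
  reify (A · B) = Cl-elim ⊢-closed λ { (a ,⊗ b) → →· (reify A a) (reify B b) }
  reify (A ＼ B) f = →＼ (reify B (f [ A ] (reflect A)))
  reify (B ／ A) f = →／ (reify B (f [ A ] (reflect A)))
  reify (A ∧ B) (a , b) = →∧ (reify A a) (reify B b)
  reify (A ∨ B) = Cl-elim ⊢-closed λ { (inj₁ a) → →∨₁ (reify A a) ; (inj₂ b) → →∨₂ (reify B b) }
  reify (![ s ] A) = Cl-elim ⊢-closed λ { (block M above , a) → →! above (reify A a) }

  ⟦_⟧* : Ctx → Pred
  ⟦ [] ⟧* = _≡ []
  ⟦ A ∷ Γ ⟧* = ⟦ A ⟧ ⊗ ⟦ Γ ⟧*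

  reflect* : ∀ Γ → ⟦ Γ ⟧* Γ
  reflect* [] = refl
  reflect* (A ∷ Γ) = reflect A ,⊗ reflect* Γ

  ⟦++⟧-split : ∀ Γ₁ Γ₂ → ⟦ Γ₁ ++ Γ₂ ⟧* ⊆ ⟦ Γ₁ ⟧* ⊗ ⟦ Γ₂ ⟧*
  ⟦++⟧-split [] Γ₂ γ = refl ,⊗ γ
  ⟦++⟧-split (A ∷ Γ₁) Γ₂ (_,⊗_ {Δa} a γ) with ⟦++⟧-split Γ₁ Γ₂ γ
  ... | _,⊗_ {Δ₁} {Δ₂} γ₁ γ₂ = subst (⟦ A ∷ Γ₁ ⟧* ⊗ ⟦ Γ₂ ⟧*) (++-assoc Δa Δ₁ Δ₂) ((a ,⊗ γ₁) ,⊗ γ₂)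

  ⟦++⟧-join : ∀ Γ₁ Γ₂ → ⟦ Γ₁ ⟧* ⊗ ⟦ Γ₂ ⟧* ⊆ ⟦ Γ₁ ++ Γ₂ ⟧*
  ⟦++⟧-join [] Γ₂ (refl ,⊗ γ₂) = γ₂
  ⟦++⟧-join (A ∷ Γ₁) Γ₂ (_,⊗_ {_} {Δ₂} (_,⊗_ {Δa} {Δ₁} a γ₁) γ₂) =
    subst ⟦ A ∷ Γ₁ ++ Γ₂ ⟧* (sym (++-assoc Δa Δ₁ Δ₂)) (a ,⊗ ⟦++⟧-join Γ₁ Γ₂ (γ₁ ,⊗ γ₂))

  Cores : Block → Pred
  Cores [] = _≡ []
  Cores ((t , A) ∷ M) = (Bangs t ∩ ⟦ A ⟧) ⊗ Cores M

  Cores⊆⟦bangs⟧ : ∀ M → Cores M ⊆ ⟦ bangs Σ M ⟧*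
  Cores⊆⟦bangs⟧ [] refl = refl
  Cores⊆⟦bangs⟧ (_ ∷ M) (c ,⊗ cs) = Cl-unit c ,⊗ Cores⊆⟦bangs⟧ M cs

  Cores⊆Bangs : ∀ M → Labelled (s ≼_) M → Cores M ⊆ Bangs s
  Cores⊆Bangs [] [] refl = block [] []
  Cores⊆Bangs (_ ∷ M) (s≼t ∷ above) ((block K t≼K , _) ,⊗ cs) with Cores⊆Bangs M above cs
  ... | block L s≼L =
    subst (Bangs _) (map-++ _ K L) (block (K ++ L) (++⁺ (All.map (≼-trans s≼t) t≼K) s≼L))

  ⟦bangs⟧-elim : ∀ M → Closed R → Cores M ⊆ R → ⟦ bangs Σ M ⟧* ⊆ R
  ⟦bangs⟧-elim [] cR f refl = f refl
  ⟦bangs⟧-elim (_ ∷ M) cR f (_,⊗_ {_} {Δ₂} c γ) =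
    Cl-elim (Closed-infix cR [] Δ₂)
      (λ {Θ} c′ → ⟦bangs⟧-elim M (Closed-prefix cR Θ) (λ cs → f (c′ ,⊗ cs)) γ) c

  -- A record rather than a function type, so that Γ and D are inferable (⟦_⟧ is not injective).
  record _⊨_ (Γ : Ctx) (D : Fm Σ) : Set where
    constructor entails
    field interpret : ⟦ Γ ⟧* ⊆ ⟦ D ⟧

  open _⊨_

  ⊨-left : ∀ Γ₁ Γ₂ {F} → ⟦ F ⟧ ⊆ Cl P → ⟦ Γ₁ ⟧* ⊗ P ⊗ ⟦ Γ₂ ⟧* ⊆ ⟦ D ⟧ → Γ₁ ++ F ∷ Γ₂ ⊨ D
  ⊨-left {D = D} Γ₁ Γ₂ {F} f h = entails λ γ → go (⟦++⟧-split Γ₁ (F ∷ Γ₂) γ)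
    where
    go : ⟦ Γ₁ ⟧* ⊗ ⟦ F ⟧ ⊗ ⟦ Γ₂ ⟧* ⊆ ⟦ D ⟧
    go (_,⊗_ {Δ₁} γ₁ (_,⊗_ {_} {Δ₂} φ γ₂)) =
      Cl-elim (Closed-infix (⟦⟧-closed D) Δ₁ Δ₂) (λ p → h (γ₁ ,⊗ p ,⊗ γ₂)) (f φ)

  ⊨-replace : ∀ Γ₁ Γ₂ → ⟦ A ⟧ ⊆ ⟦ B ⟧ → Γ₁ ++ B ∷ Γ₂ ⊨ D → Γ₁ ++ A ∷ Γ₂ ⊨ D
  ⊨-replace Γ₁ Γ₂ f (entails h) = ⊨-left Γ₁ Γ₂ (λ a → Cl-unit (f a)) (h ∘ ⟦++⟧-join Γ₁ (_ ∷ Γ₂))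

  ⊨-ax : [ A ] ⊨ A
  ⊨-ax {A} = entails λ { (a ,⊗ refl) → subst ⟦ A ⟧ (sym (++-identityʳ _)) a }

  ⊨-·→ : ∀ Γ₁ Γ₂ → Γ₁ ++ A ∷ B ∷ Γ₂ ⊨ D → Γ₁ ++ A · B ∷ Γ₂ ⊨ D
  ⊨-·→ {A} {B} {D} Γ₁ Γ₂ (entails h) = ⊨-left Γ₁ Γ₂ id premise
    where
    premise : ⟦ Γ₁ ⟧* ⊗ (⟦ A ⟧ ⊗ ⟦ B ⟧) ⊗ ⟦ Γ₂ ⟧* ⊆ ⟦ D ⟧
    premise (_,⊗_ {Δ₁} γ₁ (_,⊗_ {_} {Δ₂} (_,⊗_ {Δa} {Δb} a b) γ₂)) =
      subst ⟦ D ⟧ (cong (Δ₁ ++_) (sym (++-assoc Δa Δb Δ₂)))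
        (h (⟦++⟧-join Γ₁ (A ∷ B ∷ Γ₂) (γ₁ ,⊗ a ,⊗ b ,⊗ γ₂)))

  ⊨-→· : ∀ Γ₁ Γ₂ → Γ₁ ⊨ A → Γ₂ ⊨ B → Γ₁ ++ Γ₂ ⊨ A · B
  ⊨-→· {A} {B} Γ₁ Γ₂ (entails h) (entails k) = entails λ γ → go (⟦++⟧-split Γ₁ Γ₂ γ)
    where
    go : ⟦ Γ₁ ⟧* ⊗ ⟦ Γ₂ ⟧* ⊆ ⟦ A · B ⟧
    go (γ₁ ,⊗ γ₂) = Cl-unit (h γ₁ ,⊗ k γ₂)

  ⊨-＼→ : ∀ Π Γ₁ Γ₂ → Π ⊨ A → Γ₁ ++ B ∷ Γ₂ ⊨ D → Γ₁ ++ Π ++ A ＼ B ∷ Γ₂ ⊨ D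
  ⊨-＼→ {A} {B} {D} Π Γ₁ Γ₂ (entails h) (entails k) =
    entails λ γ → go (⟦++⟧-split Γ₁ (Π ++ _ ∷ Γ₂) γ)
    where
    go : ⟦ Γ₁ ⟧* ⊗ ⟦ Π ++ A ＼ B ∷ Γ₂ ⟧* ⊆ ⟦ D ⟧
    go (_,⊗_ {Δ₁} γ₁ δ) with ⟦++⟧-split Π (_ ∷ Γ₂) δ
    ... | _,⊗_ {Δπ} π (_,⊗_ {Δf} {Δ₂} f γ₂) =
      subst ⟦ D ⟧ (cong (Δ₁ ++_) (++-assoc Δπ Δf Δ₂))
        (k (⟦++⟧-join Γ₁ (_ ∷ Γ₂) (γ₁ ,⊗ f Δπ (h π) ,⊗ γ₂)))

  ⊨-／→ : ∀ Π Γ₁ Γ₂ → Π ⊨ A → Γ₁ ++ B ∷ Γ₂ ⊨ D → Γ₁ ++ B ／ A ∷ Π ++ Γ₂ ⊨ D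
  ⊨-／→ {A} {B} {D} Π Γ₁ Γ₂ (entails h) (entails k) =
    entails λ γ → go (⟦++⟧-split Γ₁ (_ ∷ Π ++ Γ₂) γ)
    where
    go : ⟦ Γ₁ ⟧* ⊗ ⟦ B ／ A ∷ Π ++ Γ₂ ⟧* ⊆ ⟦ D ⟧
    go (_,⊗_ {Δ₁} γ₁ (_,⊗_ {Δf} f δ)) with ⟦++⟧-split Π Γ₂ δ
    ... | _,⊗_ {Δπ} {Δ₂} π γ₂ =
      subst ⟦ D ⟧ (cong (Δ₁ ++_) (++-assoc Δf Δπ Δ₂))
        (k (⟦++⟧-join Γ₁ (_ ∷ Γ₂) (γ₁ ,⊗ f Δπ (h π) ,⊗ γ₂)))

  ⊨-→／ : ∀ Γ → Γ ++ [ A ] ⊨ B → Γ ⊨ B ／ A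
  ⊨-→／ {B = B} Γ (entails h) = entails λ {Δ} γ Θ a →
    subst ⟦ B ⟧ (cong (Δ ++_) (++-identityʳ Θ)) (h (⟦++⟧-join Γ [ _ ] (γ ,⊗ a ,⊗ refl)))

  ⊨-𝟏→ : ∀ Γ₁ Γ₂ → Γ₁ ++ Γ₂ ⊨ D → Γ₁ ++ 𝟏 ∷ Γ₂ ⊨ D
  ⊨-𝟏→ Γ₁ Γ₂ (entails h) =
    ⊨-left Γ₁ Γ₂ id λ { (γ₁ ,⊗ refl ,⊗ γ₂) → h (⟦++⟧-join Γ₁ Γ₂ (γ₁ ,⊗ γ₂)) }

  ⊨-∨→ : ∀ Γ₁ Γ₂ → Γ₁ ++ A ∷ Γ₂ ⊨ D → Γ₁ ++ B ∷ Γ₂ ⊨ D → Γ₁ ++ A ∨ B ∷ Γ₂ ⊨ D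
  ⊨-∨→ Γ₁ Γ₂ (entails h) (entails k) = ⊨-left Γ₁ Γ₂ id λ
    { (γ₁ ,⊗ inj₁ a ,⊗ γ₂) → h (⟦++⟧-join Γ₁ (_ ∷ Γ₂) (γ₁ ,⊗ a ,⊗ γ₂))
    ; (γ₁ ,⊗ inj₂ b ,⊗ γ₂) → k (⟦++⟧-join Γ₁ (_ ∷ Γ₂) (γ₁ ,⊗ b ,⊗ γ₂)) }

  ⊨-→! : ∀ M → Labelled (s ≼_) M → bangs Σ M ⊨ B → bangs Σ M ⊨ ![ s ] B
  ⊨-→! M above (entails h) = entails (⟦bangs⟧-elim M Cl-closed λ cs →
    Cl-unit (Cores⊆Bangs M above cs , h (Cores⊆⟦bangs⟧ M cs)))

  ⊨-weak : ∀ Γ₁ Γ₂ → W s → Γ₁ ++ Γ₂ ⊨ D → Γ₁ ++ ![ s ] A ∷ Γ₂ ⊨ D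
  ⊨-weak {s = s} {D = D} {A = A} Γ₁ Γ₂ w (entails h) = ⊨-left Γ₁ Γ₂ id premise
    where
    premise : ⟦ Γ₁ ⟧* ⊗ (Bangs s ∩ ⟦ A ⟧) ⊗ ⟦ Γ₂ ⟧* ⊆ ⟦ D ⟧
    premise (_,⊗_ {Δ₁} γ₁ (_,⊗_ {_} {Δ₂} (block M above , _) γ₂)) =
      Closed-⇛ (⟦⟧-closed D) (⇛-++ˡ Δ₁ (weakening-bangs M (Labelled-up W-up w above) Δ₂))
        (h (⟦++⟧-join Γ₁ Γ₂ (γ₁ ,⊗ γ₂)))

  ⊨-!-before : ∀ Γ₁ Δ Γ₂
    → (∀ M → Labelled (s ≼_) M → ⟦ ![ s ] A ⟧ (bangs Σ M) → ∀ {Δ₁ Δ′ Δ₂}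
       → ⟦ Γ₁ ⟧* Δ₁ → ⟦ Δ ⟧* Δ′ → ⟦ Γ₂ ⟧* Δ₂ → ⟦ D ⟧ (Δ₁ ++ bangs Σ M ++ Δ′ ++ Δ₂))
    → Γ₁ ++ ![ s ] A ∷ Δ ++ Γ₂ ⊨ D
  ⊨-!-before {s = s} {A = A} {D = D} Γ₁ Δ Γ₂ h = ⊨-left Γ₁ (Δ ++ Γ₂) id premise
    where
    premise : ⟦ Γ₁ ⟧* ⊗ (Bangs s ∩ ⟦ A ⟧) ⊗ ⟦ Δ ++ Γ₂ ⟧* ⊆ ⟦ D ⟧
    premise (γ₁ ,⊗ (block M above , a) ,⊗ γ) with ⟦++⟧-split Δ Γ₂ γ
    ... | δ ,⊗ γ₂ = h M above (Cl-unit (block M above , a)) γ₁ δ γ₂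

  ⊨-!-after : ∀ Γ₁ Δ Γ₂
    → (∀ M → Labelled (s ≼_) M → ⟦ ![ s ] A ⟧ (bangs Σ M) → ∀ {Δ₁ Δ′ Δ₂}
       → ⟦ Γ₁ ⟧* Δ₁ → ⟦ Δ ⟧* Δ′ → ⟦ Γ₂ ⟧* Δ₂ → ⟦ D ⟧ (Δ₁ ++ Δ′ ++ bangs Σ M ++ Δ₂))
    → Γ₁ ++ Δ ++ ![ s ] A ∷ Γ₂ ⊨ D
  ⊨-!-after {s = s} {A = A} {D = D} Γ₁ Δ Γ₂ h =
    subst (_⊨ D) (++-assoc Γ₁ Δ _) (⊨-left (Γ₁ ++ Δ) Γ₂ id premise)
    where
    premise : ⟦ Γ₁ ++ Δ ⟧* ⊗ (Bangs s ∩ ⟦ A ⟧) ⊗ ⟦ Γ₂ ⟧* ⊆ ⟦ D ⟧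
    premise (γ ,⊗ (block M above , a) ,⊗ γ₂) with ⟦++⟧-split Γ₁ Δ γ
    ... | _,⊗_ {Δ₁} {Δ′} γ₁ δ = subst ⟦ D ⟧ (sym (++-assoc Δ₁ Δ′ _))
      (h M above (Cl-unit (block M above , a)) γ₁ δ γ₂)

  ⊨-ex₁ : ∀ Γ₁ Δ Γ₂ → E s → Γ₁ ++ Δ ++ ![ s ] A ∷ Γ₂ ⊨ D → Γ₁ ++ ![ s ] A ∷ Δ ++ Γ₂ ⊨ D
  ⊨-ex₁ {D = D} Γ₁ Δ Γ₂ e (entails h) = ⊨-!-before Γ₁ Δ Γ₂ λ M above f {Δ₁} {Δ′} {Δ₂} γ₁ δ γ₂ →
    Closed-⇛ (⟦⟧-closed D) (⇛-++ˡ Δ₁ (exchange-bangs₁ M (Labelled-up E-up e above) Δ′ Δ₂))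
      (h (⟦++⟧-join Γ₁ (Δ ++ _ ∷ Γ₂) (γ₁ ,⊗ ⟦++⟧-join Δ (_ ∷ Γ₂) (δ ,⊗ f ,⊗ γ₂))))

  ⊨-ex₂ : ∀ Γ₁ Δ Γ₂ → E s → Γ₁ ++ ![ s ] A ∷ Δ ++ Γ₂ ⊨ D → Γ₁ ++ Δ ++ ![ s ] A ∷ Γ₂ ⊨ D
  ⊨-ex₂ {D = D} Γ₁ Δ Γ₂ e (entails h) = ⊨-!-after Γ₁ Δ Γ₂ λ M above f {Δ₁} {Δ′} {Δ₂} γ₁ δ γ₂ →
    Closed-⇛ (⟦⟧-closed D) (⇛-++ˡ Δ₁ (exchange-bangs₂ M (Labelled-up E-up e above) Δ′ Δ₂))
      (h (⟦++⟧-join Γ₁ (_ ∷ Δ ++ Γ₂) (γ₁ ,⊗ f ,⊗ ⟦++⟧-join Δ Γ₂ (δ ,⊗ γ₂))))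

  ⊨-ncontr₁ : ∀ Γ₁ Δ Γ₂ → C s → Γ₁ ++ ![ s ] A ∷ Δ ++ ![ s ] A ∷ Γ₂ ⊨ D
            → Γ₁ ++ ![ s ] A ∷ Δ ++ Γ₂ ⊨ D
  ⊨-ncontr₁ {D = D} Γ₁ Δ Γ₂ c (entails h) = ⊨-!-before Γ₁ Δ Γ₂ λ M above f {Δ₁} {Δ′} {Δ₂} γ₁ δ γ₂ →
    Closed-⇛ (⟦⟧-closed D) (⇛-++ˡ Δ₁ (contraction-bangs₁ M (Labelled-up C-up c above) Δ′ Δ₂))
      (h (⟦++⟧-join Γ₁ (_ ∷ Δ ++ _ ∷ Γ₂) (γ₁ ,⊗ f ,⊗ ⟦++⟧-join Δ (_ ∷ Γ₂) (δ ,⊗ f ,⊗ γ₂))))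

  ⊨-ncontr₂ : ∀ Γ₁ Δ Γ₂ → C s → Γ₁ ++ ![ s ] A ∷ Δ ++ ![ s ] A ∷ Γ₂ ⊨ D
            → Γ₁ ++ Δ ++ ![ s ] A ∷ Γ₂ ⊨ D
  ⊨-ncontr₂ {D = D} Γ₁ Δ Γ₂ c (entails h) = ⊨-!-after Γ₁ Δ Γ₂ λ M above f {Δ₁} {Δ′} {Δ₂} γ₁ δ γ₂ →
    Closed-⇛ (⟦⟧-closed D) (⇛-++ˡ Δ₁ (contraction-bangs₂ M (Labelled-up C-up c above) Δ′ Δ₂))
      (h (⟦++⟧-join Γ₁ (_ ∷ Δ ++ _ ∷ Γ₂) (γ₁ ,⊗ f ,⊗ ⟦++⟧-join Δ (_ ∷ Γ₂) (δ ,⊗ f ,⊗ γ₂))))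

  ⊨-cut : ∀ Π Γ₁ Γ₂ → Π ⊨ A → Γ₁ ++ A ∷ Γ₂ ⊨ D → Γ₁ ++ Π ++ Γ₂ ⊨ D
  ⊨-cut {A} {D} Π Γ₁ Γ₂ (entails h) (entails k) = entails λ γ → go (⟦++⟧-split Γ₁ (Π ++ Γ₂) γ)
    where
    go : ⟦ Γ₁ ⟧* ⊗ ⟦ Π ++ Γ₂ ⟧* ⊆ ⟦ D ⟧
    go (γ₁ ,⊗ δ) with ⟦++⟧-split Π Γ₂ δ
    ... | π ,⊗ γ₂ = k (⟦++⟧-join Γ₁ (_ ∷ Γ₂) (γ₁ ,⊗ h π ,⊗ γ₂))

  soundness : ∀ {b} → Der Σ b Γ D → Γ ⊨ D
  soundness ax = ⊨-ax
  soundness →𝟏 = entails λ { refl → Cl-unit refl }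
  soundness (·→ {Γ₁} {Γ₂} d) = ⊨-·→ Γ₁ Γ₂ (soundness d)
  soundness (→· {Γ₁} {Γ₂} d e) = ⊨-→· Γ₁ Γ₂ (soundness d) (soundness e)
  soundness (＼→ {Π} {Γ₁} {Γ₂} d e) = ⊨-＼→ Π Γ₁ Γ₂ (soundness d) (soundness e)
  soundness (→＼ d) = entails λ γ _ a → interpret (soundness d) (a ,⊗ γ)
  soundness (／→ {Π} {Γ₁} {Γ₂} d e) = ⊨-／→ Π Γ₁ Γ₂ (soundness d) (soundness e)
  soundness (→／ {Π} d) = ⊨-→／ Π (soundness d)
  soundness (𝟏→ {Γ₁} {Γ₂} d) = ⊨-𝟏→ Γ₁ Γ₂ (soundness d)
  soundness (∨→ {Γ₁} {Γ₂} d e) = ⊨-∨→ Γ₁ Γ₂ (soundness d) (soundness e)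
  soundness (→∨₁ d) = entails λ γ → Cl-unit (inj₁ (interpret (soundness d) γ))
  soundness (→∨₂ d) = entails λ γ → Cl-unit (inj₂ (interpret (soundness d) γ))
  soundness (∧₁→ {Γ₁} {Γ₂} d) = ⊨-replace Γ₁ Γ₂ proj₁ (soundness d)
  soundness (∧₂→ {Γ₁} {Γ₂} d) = ⊨-replace Γ₁ Γ₂ proj₂ (soundness d)
  soundness (→∧ d e) = entails λ γ → interpret (soundness d) γ , interpret (soundness e) γ
  soundness (!→ {Γ₁} {Γ₂} {A = A} d) = ⊨-replace Γ₁ Γ₂ (Cl-elim (⟦⟧-closed A) proj₂) (soundness d)
  soundness (→! {M} above d) = ⊨-→! M above (soundness d)
  soundness (weak {Γ₁} {Γ₂} w d) = ⊨-weak Γ₁ Γ₂ w (soundness d)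
  soundness (ncontr₁ {Γ₁} {Δ} {Γ₂} c d) = ⊨-ncontr₁ Γ₁ Δ Γ₂ c (soundness d)
  soundness (ncontr₂ {Γ₁} {Δ} {Γ₂} c d) = ⊨-ncontr₂ Γ₁ Δ Γ₂ c (soundness d)
  soundness (ex₁ {Γ₁} {Δ} {Γ₂} e d) = ⊨-ex₁ Γ₁ Δ Γ₂ e (soundness d)
  soundness (ex₂ {Γ₁} {Δ} {Γ₂} e d) = ⊨-ex₂ Γ₁ Δ Γ₂ e (soundness d)
  soundness (cut {Π} {Γ₁} {Γ₂} _ d e) = ⊨-cut Π Γ₁ Γ₂ (soundness d) (soundness e)

  cut-elimination : ∀ {b} → Der Σ b Γ A → Γ ⊢ A
  cut-elimination {Γ} {A} d = reify A (interpret (soundness d) (reflect* Γ))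
  from-cut-free : ∀ {b} → Γ ⊢ A → Der Σ b Γ A
  from-cut-free ax = ax
  from-cut-free →𝟏 = →𝟏
  from-cut-free (·→ d) = ·→ (from-cut-free d)
  from-cut-free (→· d e) = →· (from-cut-free d) (from-cut-free e)
  from-cut-free (＼→ d e) = ＼→ (from-cut-free d) (from-cut-free e)
  from-cut-free (→＼ d) = →＼ (from-cut-free d)
  from-cut-free (／→ d e) = ／→ (from-cut-free d) (from-cut-free e)
  from-cut-free (→／ d) = →／ (from-cut-free d)
  from-cut-free (𝟏→ d) = 𝟏→ (from-cut-free d)
  from-cut-free (∨→ d e) = ∨→ (from-cut-free d) (from-cut-free e)
  from-cut-free (→∨₁ d) = →∨₁ (from-cut-free d)
  from-cut-free (→∨₂ d) = →∨₂ (from-cut-free d)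
  from-cut-free (∧₁→ d) = ∧₁→ (from-cut-free d)
  from-cut-free (∧₂→ d) = ∧₂→ (from-cut-free d)
  from-cut-free (→∧ d e) = →∧ (from-cut-free d) (from-cut-free e)
  from-cut-free (!→ d) = !→ (from-cut-free d)
  from-cut-free (→! above d) = →! above (from-cut-free d)
  from-cut-free (weak w d) = weak w (from-cut-free d)
  from-cut-free (ncontr₁ c d) = ncontr₁ c (from-cut-free d)
  from-cut-free (ncontr₂ c d) = ncontr₂ c (from-cut-free d)
  from-cut-free (ex₁ e d) = ex₁ e (from-cut-free d)
  from-cut-free (ex₂ e d) = ex₂ e (from-cut-free d)

corollary1 : (Σ : SubexpSig) (Γ : List (Fm Σ)) (A : Fm Σ) →
    (DerCut Σ Γ A → DerCutFree Σ Γ A) × (DerCutFree Σ Γ A → DerCut Σ Γ A)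
corollary1 Σ Γ A = cut-elimination , from-cut-free
  where open CutElimination Σ
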